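{- Let $k$ be a positive integer, let $G_1,G_2$ be disjoint copies of $C_{3k+2}$, and let $f:V(G_1)\to V(G_2)$ be a function. If there exist two vertices $x,y\in V(G_1)$ such that $d_{G_1}(x,y)\equiv 1\pmod 3$ and $d_{G_2}(f(x),f(y))\not\equiv 1\pmod 3$, then $\gamma(C(C_{3k+2},f))<2\gamma(C_{3k+2})$.
   Context: For disjoint copies $G_1,G_2$ of a graph $G$ and a function $f:V(G_1)\to V(G_2)$, the functigraph $C(G,f)$ has vertex set $V(G_1)\cup V(G_2)$ and edge set $E(G_1)\cup E(G_2)\cup\{uv : u\in V(G_1), v\in V(G_2), v=f(u)\}$. $\gamma$ denotes domination number. $d_{G_i}(x,y)$ denotes the distance between $x$ and $y$ in the cycle $G_i$. -}

module Defs where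

open import Data.Nat using (ℕ; zero; suc; _+_; _*_; _%_; _<_; _≤_)
open import Data.Fin using (Fin; toℕ; splitAt)
open import Data.Fin.Subset using (Subset; _∈_; ∣_∣)
open import Data.Sum using (_⊎_; inj₁; inj₂)
open import Data.Product using (Σ; _×_; ∃; ∃-syntax)
open import Relation.Binary.PropositionalEquality using (_≡_)

record Graph : Set₁ where
  field
    order : ℕ
    Adj   : Fin order → Fin order → Set
open Graph public

cycleAdj : (n : ℕ) → Fin n → Fin n → Set
cycleAdj zero () _
cycleAdj (suc m) i j =
  (toℕ j ≡ (suc (toℕ i)) % suc m) ⊎ (toℕ i ≡ (suc (toℕ j)) % suc m)

Cycle : ℕ → Graph
Cycle n = record { order = n ; Adj = cycleAdj n }

-- Adjacency in the functigraph C(G,f): vertices of G₁ are the first `order G`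
-- elements of Fin (order G + order G), those of G₂ the last ones.
functiAdjSum : (G : Graph) → (Fin (order G) → Fin (order G)) →
               Fin (order G) ⊎ Fin (order G) → Fin (order G) ⊎ Fin (order G) → Set
functiAdjSum G f (inj₁ u) (inj₁ v) = Adj G u v
functiAdjSum G f (inj₂ u) (inj₂ v) = Adj G u v
functiAdjSum G f (inj₁ u) (inj₂ v) = v ≡ f u
functiAdjSum G f (inj₂ v) (inj₁ u) = v ≡ f u

Functigraph : (G : Graph) → (Fin (order G) → Fin (order G)) → Graph
Functigraph G f = record
  { order = order G + order G
  ; Adj   = λ a b → functiAdjSum G f (splitAt (order G) a) (splitAt (order G) b) }

data Walk (G : Graph) : Fin (order G) → Fin (order G) → ℕ → Set where
  here : ∀ {x} → Walk G x x 0
  step : ∀ {x y z m} → Adj G x y → Walk G y z m → Walk G x z (suc m)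

IsDist : (G : Graph) → Fin (order G) → Fin (order G) → ℕ → Set
IsDist G x y d = Walk G x y d × (∀ m → Walk G x y m → d ≤ m)

Dominating : (G : Graph) → Subset (order G) → Set
Dominating G S = ∀ v → (v ∈ S) ⊎ (∃[ u ] (u ∈ S × Adj G u v))

IsDominationNumber : Graph → ℕ → Set
IsDominationNumber G g =
  (∃[ S ] (Dominating G S × ∣ S ∣ ≡ g)) × (∀ S → Dominating G S → g ≤ ∣ S ∣)

-- Each vertex of C_n dominates at most three vertices, so γ(C_{3k+2}) ≥ k + 1 and it
-- suffices to dominate the functigraph with 2k + 1 vertices. Measure positions in G₁ as
-- forward offsets from x and in G₂ as forward offsets from f x, and let r and s be the
-- offsets of y and f y. Cut G₁ into the arcs [0, r) and [r, n) and choose every third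
-- vertex of each arc from its position 2 on; cut G₂ at 0 and s and choose every third
-- vertex of each arc from its position 0 on. As r ≡ 1 (mod 3), the first choice has
-- k vertices and dominates all of G₁ except x and y; as s ≢ 1, the second has k + 1
-- vertices, dominates G₂ and contains f x and f y, which dominate x and y. The distance
-- hypotheses are exactly r ≡ 1 and s ≢ 1, because a distance is either the offset or
-- its complement n minus the offset, and n ≡ 2 (mod 3).
module Submission where

open import Data.Bool using (Bool; true; false; if_then_else_)
open import Data.Bool.Properties using (T-≡)
open import Data.Empty using (⊥-elim)
open import Data.Fin using (Fin; zero; suc; toℕ; fromℕ<; splitAt; _↑ˡ_; _↑ʳ_)
open import Data.Fin.Permutation using (Permutation; permutation)
open import Data.Fin.Properties using (toℕ-fromℕ<; toℕ-injective; toℕ<n; splitAt-↑ˡ; splitAt-↑ʳ; _≟_)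
open import Data.Fin.Subset using (Subset; _∈_; ∣_∣)
open import Data.Nat
  using (ℕ; NonZero; zero; suc; _+_; _*_; _∸_; _%_; _⊓_; _<_; _≤_; _≡ᵇ_; _<ᵇ_; z≤n; s≤s; s≤s⁻¹; z<s)
open import Data.Nat.DivMod using (m%n<n; [m+n]%n≡m%n; m<n⇒m%n≡m; %-distribˡ-+; m%n%n≡m%n)
open import Data.Nat.Properties hiding (_≟_)
open import Algebra.Properties.CommutativeMonoid.Sum +-0-commutativeMonoid
  using (sum; sum-cong-≗; sum-permute; ∑-distrib-+)
open import Data.Nat.Tactic.RingSolver using (solve-∀)
open import Data.Product using (_×_; _,_; ∃-syntax)
open import Data.Sum using (_⊎_; inj₁; inj₂; [_,_]) renaming (map to ⊎-map)
open import Data.Sum.Properties using ([,]-map)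
open import Data.Vec using ([]; _∷_; lookup; tabulate)
open import Data.Vec.Functional using (Vector; _++_)
open import Data.Vec.Properties using (lookup⇒[]=; []=⇒lookup; lookup∘tabulate)
open import Function.Base using (_∘_; id)
open import Function.Bundles using (_⇔_; mk⇔; Equivalence)
open import Relation.Nullary using (yes; no; contradiction)
open import Relation.Binary.PropositionalEquality
  using (_≡_; _≢_; refl; sym; trans; cong; cong₂; subst; subst₂; module ≡-Reasoning)
open import Defs

-- Residues modulo 3

mod3 : ℕ → ℕ
mod3 0 = 0
mod3 1 = 1
mod3 2 = 2
mod3 (suc (suc (suc t))) = mod3 t

div3 : ℕ → ℕ
div3 0 = 0
div3 1 = 0
div3 2 = 0
div3 (suc (suc (suc t))) = suc (div3 t)

%3≡mod3 : ∀ t → t % 3 ≡ mod3 t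
%3≡mod3 0 = refl
%3≡mod3 1 = refl
%3≡mod3 2 = refl
%3≡mod3 (suc (suc (suc t))) = %3≡mod3 t

m≡div3*3+mod3 : ∀ t → t ≡ div3 t * 3 + mod3 t
m≡div3*3+mod3 0 = refl
m≡div3*3+mod3 1 = refl
m≡div3*3+mod3 2 = refl
m≡div3*3+mod3 (suc (suc (suc t))) = cong (3 +_) (m≡div3*3+mod3 t)

mod3<3 : ∀ t → mod3 t < 3
mod3<3 0 = s≤s z≤n
mod3<3 1 = s≤s (s≤s z≤n)
mod3<3 2 = s≤s (s≤s (s≤s z≤n))
mod3<3 (suc (suc (suc t))) = mod3<3 t

mod3-*3+ : ∀ q t → mod3 (q * 3 + t) ≡ mod3 t
mod3-*3+ zero t = refl
mod3-*3+ (suc q) t = mod3-*3+ q t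

residue-sum : ∀ ρ σ → ρ < 3 → σ < 3 → mod3 (ρ + σ) ≡ 2 → ρ + σ ≡ 2
residue-sum 0 2 _ _ _ = refl
residue-sum 1 1 _ _ _ = refl
residue-sum 2 0 _ _ _ = refl
residue-sum 0 0 _ _ ()
residue-sum 0 1 _ _ ()
residue-sum 1 0 _ _ ()
residue-sum 1 2 _ _ ()
residue-sum 2 1 _ _ ()
residue-sum 2 2 _ _ ()
residue-sum (suc (suc (suc _))) _ (s≤s (s≤s (s≤s ()))) _ _
residue-sum _ (suc (suc (suc _))) _ (s≤s (s≤s (s≤s ()))) _

+-div3-mod3 : ∀ a b → a + b ≡ (div3 a + div3 b) * 3 + (mod3 a + mod3 b)
+-div3-mod3 a b =
  trans (cong₂ _+_ (m≡div3*3+mod3 a) (m≡div3*3+mod3 b)) (regroup (div3 a) (mod3 a) (div3 b) (mod3 b))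
  where
    regroup : ∀ p ρ q σ → (p * 3 + ρ) + (q * 3 + σ) ≡ (p + q) * 3 + (ρ + σ)
    regroup = solve-∀

mod3-+≡2 : ∀ a b → mod3 (a + b) ≡ 2 → mod3 a + mod3 b ≡ 2
mod3-+≡2 a b eq = residue-sum (mod3 a) (mod3 b) (mod3<3 a) (mod3<3 b) (begin
    mod3 (mod3 a + mod3 b)                              ≡⟨ mod3-*3+ (div3 a + div3 b) _ ⟨
    mod3 ((div3 a + div3 b) * 3 + (mod3 a + mod3 b))    ≡⟨ cong mod3 (+-div3-mod3 a b) ⟨
    mod3 (a + b)                                        ≡⟨ eq ⟩
    2                                                   ∎)
  where open ≡-Reasoning

div3-+ : ∀ a b k → a + b ≡ 2 + k * 3 → mod3 a + mod3 b ≡ 2 → div3 a + div3 b ≡ k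
div3-+ a b k eq residues = *-cancelʳ-≡ _ k 3 (+-cancelʳ-≡ 2 _ _ (begin
    (div3 a + div3 b) * 3 + 2                      ≡⟨ cong ((div3 a + div3 b) * 3 +_) residues ⟨
    (div3 a + div3 b) * 3 + (mod3 a + mod3 b)      ≡⟨ +-div3-mod3 a b ⟨
    a + b                                          ≡⟨ eq ⟩
    2 + k * 3                                      ≡⟨ +-comm 2 (k * 3) ⟩
    k * 3 + 2                                      ∎))
  where open ≡-Reasoning

complement-of-1 : ∀ {ρ σ} → ρ + σ ≡ 2 → σ ≡ 1 → ρ ≡ 1
complement-of-1 {ρ} eq refl = +-cancelʳ-≡ 1 ρ 1 eq

residue-among-three : ∀ {ρ} j → ρ < 3 → mod3 j ≡ ρ ⊎ mod3 (suc j) ≡ ρ ⊎ mod3 (suc (suc j)) ≡ ρ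
residue-among-three {0} zero _ = inj₁ refl
residue-among-three {1} zero _ = inj₂ (inj₁ refl)
residue-among-three {2} zero _ = inj₂ (inj₂ refl)
residue-among-three {suc (suc (suc _))} zero (s≤s (s≤s (s≤s ())))
residue-among-three (suc j) ρ<3 with residue-among-three j ρ<3
... | inj₁ e        = inj₂ (inj₂ e)
... | inj₂ (inj₁ e) = inj₁ e
... | inj₂ (inj₂ e) = inj₂ (inj₁ e)

residue-near : ∀ {ρ} i → ρ < 3 → ρ ≤ suc i →
  mod3 i ≡ ρ ⊎ mod3 (suc i) ≡ ρ ⊎ ∃[ i′ ] (i ≡ suc i′ × mod3 i′ ≡ ρ)
residue-near {0} zero _ _ = inj₁ refl
residue-near {1} zero _ _ = inj₂ (inj₁ refl)
residue-near {suc (suc _)} zero _ (s≤s ())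
residue-near (suc i) ρ<3 _ with residue-among-three i ρ<3
... | inj₁ e        = inj₂ (inj₂ (i , refl , e))
... | inj₂ (inj₁ e) = inj₁ e
... | inj₂ (inj₂ e) = inj₂ (inj₁ e)

2<3 : 2 < 3
2<3 = s≤s (s≤s (s≤s z≤n))

2≤suc : ∀ {i} → i ≢ 0 → 2 ≤ suc i
2≤suc {zero}  i≢0 = contradiction refl i≢0
2≤suc {suc i} _   = s≤s (s≤s z≤n)

-- Counting chosen positions

bit : Bool → ℕ
bit true  = 1
bit false = 0

countBelow : (ℕ → Bool) → ℕ → ℕ
countBelow g zero    = 0
countBelow g (suc L) = bit (g 0) + countBelow (λ t → g (suc t)) L

countBelow-+ : ∀ a b g → countBelow g (a + b) ≡ countBelow g a + countBelow (λ t → g (a + t)) b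
countBelow-+ zero    b g = refl
countBelow-+ (suc a) b g =
  trans (cong (bit (g 0) +_) (countBelow-+ a b (λ t → g (suc t)))) (sym (+-assoc (bit (g 0)) _ _))

countBelow-cong : ∀ L {g h} → (∀ t → t < L → g t ≡ h t) → countBelow g L ≡ countBelow h L
countBelow-cong zero    eq = refl
countBelow-cong (suc L) eq =
  cong₂ (λ b c → bit b + c) (eq 0 (s≤s z≤n)) (countBelow-cong L (λ t t<L → eq (suc t) (s≤s t<L)))

residues : ℕ → ℕ → ℕ
residues α = countBelow (λ t → mod3 t ≡ᵇ α)

residues-3+ : ∀ {α} L → α < 3 → residues α (3 + L) ≡ suc (residues α L)
residues-3+ {0} L _ = refl
residues-3+ {1} L _ = refl
residues-3+ {2} L _ = refl
residues-3+ {suc (suc (suc _))} L (s≤s (s≤s (s≤s ())))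

residues-*3+ : ∀ {α} q ρ → α < 3 → residues α (q * 3 + ρ) ≡ q + residues α ρ
residues-*3+ zero    ρ α<3 = refl
residues-*3+ (suc q) ρ α<3 = trans (residues-3+ (q * 3 + ρ) α<3) (cong suc (residues-*3+ q ρ α<3))

residues-div3 : ∀ {α} L → α < 3 → residues α L ≡ div3 L + residues α (mod3 L)
residues-div3 L α<3 = trans (cong (residues _) (m≡div3*3+mod3 L)) (residues-*3+ (div3 L) (mod3 L) α<3)

residues-0-pair : ∀ ρ σ → ρ + σ ≡ 2 → ρ ≢ 1 → residues 0 ρ + residues 0 σ ≡ 1
residues-0-pair 0 σ refl _ = refl
residues-0-pair 1 σ refl ρ≢1 = contradiction refl ρ≢1
residues-0-pair 2 σ refl _ = refl
residues-0-pair (suc (suc (suc _))) σ () _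

≡ᵇ-true : ∀ {a b} → a ≡ b → (a ≡ᵇ b) ≡ true
≡ᵇ-true {a} {b} eq = Equivalence.to T-≡ (≡⇒≡ᵇ a b eq)

-- Cutting the offsets 0 … L − 1 of a cycle into the arcs [0, s) and [s, L), stride3 s α
-- chooses the offsets whose distance from the start of their arc is ≡ α (mod 3).
opaque
  stride3 : ℕ → ℕ → ℕ → Bool
  stride3 s α t = if t <ᵇ s then mod3 t ≡ᵇ α else mod3 (t ∸ s) ≡ᵇ α

  stride3-below : ∀ {s α t} → t < s → stride3 s α t ≡ (mod3 t ≡ᵇ α)
  stride3-below t<s rewrite Equivalence.to T-≡ (<⇒<ᵇ t<s) = refl

  stride3-above : ∀ {s α t} → s ≤ t → stride3 s α t ≡ (mod3 (t ∸ s) ≡ᵇ α)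
  stride3-above {s} {α} {t} s≤t with t <ᵇ s in eq
  ... | true  = ⊥-elim (≤⇒≯ s≤t (<ᵇ⇒< t s (Equivalence.from T-≡ eq)))
  ... | false = refl

  stride3-origin : ∀ s → stride3 s 0 0 ≡ true
  stride3-origin zero    = refl
  stride3-origin (suc s) = refl

stride3-below-∈ : ∀ {s α t} → t < s → mod3 t ≡ α → stride3 s α t ≡ true
stride3-below-∈ t<s eq = trans (stride3-below t<s) (≡ᵇ-true eq)

stride3-above-∈ : ∀ {s α t} → s ≤ t → mod3 (t ∸ s) ≡ α → stride3 s α t ≡ true
stride3-above-∈ s≤t eq = trans (stride3-above s≤t) (≡ᵇ-true eq)

stride3-start : ∀ s → stride3 s 0 s ≡ true
stride3-start s = stride3-above-∈ {s} ≤-refl (cong mod3 (n∸n≡0 s))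

countBelow-stride3 : ∀ {s L} α → s ≤ L → countBelow (stride3 s α) L ≡ residues α s + residues α (L ∸ s)
countBelow-stride3 {s} {L} α s≤L = begin
    countBelow (stride3 s α) L
      ≡⟨ cong (countBelow _) (m+[n∸m]≡n s≤L) ⟨
    countBelow (stride3 s α) (s + (L ∸ s))
      ≡⟨ countBelow-+ s (L ∸ s) _ ⟩
    countBelow (stride3 s α) s + countBelow (λ t → stride3 s α (s + t)) (L ∸ s)
      ≡⟨ cong₂ _+_ (countBelow-cong s (λ t t<s → stride3-below t<s))
                   (countBelow-cong (L ∸ s) (λ t _ → trans (stride3-above (m≤m+n s t))
                                                          (cong (λ i → mod3 i ≡ᵇ α) (m+n∸m≡n s t)))) ⟩
    residues α s + residues α (L ∸ s)
      ∎
  where open ≡-Reasoning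

-- Cardinalities and functigraphs

∣S∣≡sum-bit : ∀ {N} (S : Subset N) → ∣ S ∣ ≡ sum (λ i → bit (lookup S i))
∣S∣≡sum-bit []          = refl
∣S∣≡sum-bit (true ∷ S)  = cong suc (∣S∣≡sum-bit S)
∣S∣≡sum-bit (false ∷ S) = ∣S∣≡sum-bit S

sum-++ : ∀ {a} {A : Set a} {N M} (F : A → ℕ) (u : Vector A N) (v : Vector A M) →
         sum (F ∘ (u ++ v)) ≡ sum (F ∘ u) + sum (F ∘ v)
sum-++ {N = zero}  F u v = refl
sum-++ {N = suc N} F u v = trans (cong (F (u zero) +_) tail-eq) (sym (+-assoc (F (u zero)) _ _))
  where
    tail-eq : sum (λ i → F ((u ++ v) (suc i))) ≡ sum (F ∘ (λ i → u (suc i))) + sum (F ∘ v)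
    tail-eq = trans (sum-cong-≗ (λ i → cong F ([,]-map (splitAt N i)))) (sum-++ F (λ i → u (suc i)) v)

sum-mono-≤ : ∀ {N} {f g : Fin N → ℕ} → (∀ i → f i ≤ g i) → sum f ≤ sum g
sum-mono-≤ {zero}  f≤g = z≤n
sum-mono-≤ {suc N} f≤g = +-mono-≤ (f≤g zero) (sum-mono-≤ (λ i → f≤g (suc i)))

sum-const-1 : ∀ N → sum {N} (λ _ → 1) ≡ N
sum-const-1 zero    = refl
sum-const-1 (suc N) = cong suc (sum-const-1 N)

sum≡countBelow : ∀ N (g : ℕ → Bool) → sum {N} (λ t → bit (g (toℕ t))) ≡ countBelow g N
sum≡countBelow zero    g = refl
sum≡countBelow (suc N) g = cong (bit (g 0) +_) (sum≡countBelow N (λ t → g (suc t)))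

DominatedBy : (G : Graph) → (Fin (order G) → Bool) → Fin (order G) → Set
DominatedBy G c w = c w ≡ true ⊎ ∃[ u ] (c u ≡ true × Adj G u w)

∈-tabulate : ∀ {N} {h : Fin N → Bool} {i} → h i ≡ true → i ∈ tabulate h
∈-tabulate {h = h} {i} eq = lookup⇒[]= i (tabulate h) (trans (lookup∘tabulate h i) eq)

module _ (G : Graph) (f : Fin (order G) → Fin (order G)) (c₁ c₂ : Fin (order G) → Bool) where
  private
    N : ℕ
    N = order G

    ↑ˡ-∈ : ∀ {u} → c₁ u ≡ true → u ↑ˡ N ∈ tabulate (c₁ ++ c₂)
    ↑ˡ-∈ {u} c₁u = ∈-tabulate (trans (cong [ c₁ , c₂ ] (splitAt-↑ˡ N u N)) c₁u)

    ↑ʳ-∈ : ∀ {u} → c₂ u ≡ true → N ↑ʳ u ∈ tabulate (c₁ ++ c₂)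
    ↑ʳ-∈ {u} c₂u = ∈-tabulate (trans (cong [ c₁ , c₂ ] (splitAt-↑ʳ N N u)) c₂u)

    ↑ˡ-adj : ∀ {u z} → functiAdjSum G f (inj₁ u) z → functiAdjSum G f (splitAt N (u ↑ˡ N)) z
    ↑ˡ-adj {u} {z} = subst (λ y → functiAdjSum G f y z) (sym (splitAt-↑ˡ N u N))

    ↑ʳ-adj : ∀ {u z} → functiAdjSum G f (inj₂ u) z → functiAdjSum G f (splitAt N (N ↑ʳ u)) z
    ↑ʳ-adj {u} {z} = subst (λ y → functiAdjSum G f y z) (sym (splitAt-↑ʳ N N u))

  functigraph-dominating : (∀ w → DominatedBy G c₁ w ⊎ c₂ (f w) ≡ true) → (∀ w → DominatedBy G c₂ w) →
                           Dominating (Functigraph G f) (tabulate (c₁ ++ c₂))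
  functigraph-dominating dom₁ dom₂ v with splitAt N v in eq
  ... | inj₁ w with dom₁ w
  ...   | inj₁ (inj₁ c₁w)             = inj₁ (∈-tabulate (trans (cong [ c₁ , c₂ ] eq) c₁w))
  ...   | inj₁ (inj₂ (u , c₁u , u~w)) = inj₂ (u ↑ˡ N , ↑ˡ-∈ c₁u , ↑ˡ-adj u~w)
  ...   | inj₂ c₂fw                   = inj₂ (N ↑ʳ f w , ↑ʳ-∈ c₂fw , ↑ʳ-adj refl)
  functigraph-dominating dom₁ dom₂ v | inj₂ w with dom₂ w
  ...   | inj₁ c₂w             = inj₁ (∈-tabulate (trans (cong [ c₁ , c₂ ] eq) c₂w))
  ...   | inj₂ (u , c₂u , u~w) = inj₂ (N ↑ʳ u , ↑ʳ-∈ c₂u , ↑ʳ-adj u~w)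

∣tabulate-++∣ : ∀ {N} (c₁ c₂ : Fin N → Bool) →
  ∣ tabulate (c₁ ++ c₂) ∣ ≡ sum (bit ∘ c₁) + sum (bit ∘ c₂)
∣tabulate-++∣ c₁ c₂ = trans (∣S∣≡sum-bit (tabulate (c₁ ++ c₂)))
  (trans (sum-cong-≗ (λ i → cong bit (lookup∘tabulate (c₁ ++ c₂) i))) (sum-++ bit c₁ c₂))

-- Offsets on a cycle

[m+n%d]%d≡[m+n]%d : ∀ a x d → .{{_ : NonZero d}} → (a + x % d) % d ≡ (a + x) % d
[m+n%d]%d≡[m+n]%d a x d = begin
    (a + x % d) % d         ≡⟨ %-distribˡ-+ a (x % d) d ⟩
    (a % d + x % d % d) % d ≡⟨ cong (λ z → (a % d + z) % d) (m%n%n≡m%n x d) ⟩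
    (a % d + x % d) % d     ≡⟨ %-distribˡ-+ a x d ⟨
    (a + x) % d             ∎
  where open ≡-Reasoning

module CyclicOffsets (m : ℕ) where
  n : ℕ
  n = suc m

  C : Graph
  C = Cycle n

  next : Fin n → Fin n
  next i = fromℕ< (m%n<n (suc (toℕ i)) n)

  next^ : ℕ → Fin n → Fin n
  next^ zero    a = a
  next^ (suc j) a = next (next^ j a)

  prev : Fin n → Fin n
  prev = next^ m

  toℕ-next^ : ∀ j a → toℕ (next^ j a) ≡ (toℕ a + j) % n
  toℕ-next^ zero    a = sym (trans (cong (_% n) (+-identityʳ (toℕ a))) (m<n⇒m%n≡m (toℕ<n a)))
  toℕ-next^ (suc j) a = begin
      toℕ (next (next^ j a))    ≡⟨ toℕ-fromℕ< _ ⟩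
      (1 + toℕ (next^ j a)) % n ≡⟨ cong (λ z → (1 + z) % n) (toℕ-next^ j a) ⟩
      (1 + (toℕ a + j) % n) % n ≡⟨ [m+n%d]%d≡[m+n]%d 1 (toℕ a + j) n ⟩
      suc (toℕ a + j) % n       ≡⟨ cong (_% n) (+-suc (toℕ a) j) ⟨
      (toℕ a + suc j) % n       ∎
    where open ≡-Reasoning

  next^-+ : ∀ i j a → next^ (i + j) a ≡ next^ i (next^ j a)
  next^-+ zero    j a = refl
  next^-+ (suc i) j a = cong next (next^-+ i j a)

  next^-next : ∀ j a → next^ j (next a) ≡ next^ (suc j) a
  next^-next zero    a = refl
  next^-next (suc j) a = cong next (next^-next j a)

  next^-period : ∀ a → next^ n a ≡ a
  next^-period a = toℕ-injective (begin
      toℕ (next^ n a)   ≡⟨ toℕ-next^ n a ⟩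
      (toℕ a + n) % n   ≡⟨ [m+n]%n≡m%n (toℕ a) n ⟩
      toℕ a % n         ≡⟨ m<n⇒m%n≡m (toℕ<n a) ⟩
      toℕ a             ∎)
    where open ≡-Reasoning

  next-prev : ∀ a → next (prev a) ≡ a
  next-prev = next^-period

  prev-next : ∀ a → prev (next a) ≡ a
  prev-next a = trans (next^-next m a) (next^-period a)

  i+[j+[n∸i]]≡j+n : ∀ {i} j → i ≤ n → i + (j + (n ∸ i)) ≡ j + n
  i+[j+[n∸i]]≡j+n {i} j i≤n = trans (+-comm i _) (trans (+-assoc j _ i) (cong (j +_) (m∸n+n≡m i≤n)))

  opaque
    offset : Fin n → Fin n → ℕ
    offset a b = (toℕ b + (n ∸ toℕ a)) % n

    offset<n : ∀ a b → offset a b < n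
    offset<n a b = m%n<n (toℕ b + (n ∸ toℕ a)) n

    next^-offset : ∀ a b → next^ (offset a b) a ≡ b
    next^-offset a b = toℕ-injective (begin
        toℕ (next^ (offset a b) a)             ≡⟨ toℕ-next^ (offset a b) a ⟩
        (toℕ a + offset a b) % n               ≡⟨ [m+n%d]%d≡[m+n]%d (toℕ a) _ n ⟩
        (toℕ a + (toℕ b + (n ∸ toℕ a))) % n    ≡⟨ cong (_% n) (i+[j+[n∸i]]≡j+n (toℕ b) (<⇒≤ (toℕ<n a))) ⟩
        (toℕ b + n) % n                        ≡⟨ [m+n]%n≡m%n (toℕ b) n ⟩
        toℕ b % n                              ≡⟨ m<n⇒m%n≡m (toℕ<n b) ⟩
        toℕ b                                  ∎)
      where open ≡-Reasoning

    offset-next^ : ∀ a j → j < n → offset a (next^ j a) ≡ j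
    offset-next^ a j j<n = begin
        (toℕ (next^ j a) + (n ∸ toℕ a)) % n     ≡⟨ cong (λ z → (z + (n ∸ toℕ a)) % n) (toℕ-next^ j a) ⟩
        ((toℕ a + j) % n + (n ∸ toℕ a)) % n     ≡⟨ cong (_% n) (+-comm ((toℕ a + j) % n) _) ⟩
        ((n ∸ toℕ a) + (toℕ a + j) % n) % n     ≡⟨ [m+n%d]%d≡[m+n]%d (n ∸ toℕ a) (toℕ a + j) n ⟩
        ((n ∸ toℕ a) + (toℕ a + j)) % n         ≡⟨ cong (_% n) (+-comm (n ∸ toℕ a) _) ⟩
        (toℕ a + j + (n ∸ toℕ a)) % n           ≡⟨ cong (_% n) (+-assoc (toℕ a) j _) ⟩
        (toℕ a + (j + (n ∸ toℕ a))) % n         ≡⟨ cong (_% n) (i+[j+[n∸i]]≡j+n j (<⇒≤ (toℕ<n a))) ⟩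
        (j + n) % n                             ≡⟨ [m+n]%n≡m%n j n ⟩
        j % n                                   ≡⟨ m<n⇒m%n≡m j<n ⟩
        j                                       ∎
      where open ≡-Reasoning

  offset-≡ : ∀ a b {j} → j < n → next^ j a ≡ b → offset a b ≡ j
  offset-≡ a _ {j} j<n refl = offset-next^ a j j<n

  offset-injective : ∀ a {b c} → offset a b ≡ offset a c → b ≡ c
  offset-injective a {b} {c} eq = trans (sym (next^-offset a b)) (trans (cong (λ j → next^ j a) eq) (next^-offset a c))

  offset-self : ∀ a → offset a a ≡ 0
  offset-self a = offset-≡ a a (s≤s z≤n) refl

  offset-next : ∀ a w → suc (offset a w) < n → offset a (next w) ≡ suc (offset a w)
  offset-next a w lt = offset-≡ a (next w) lt (cong next (next^-offset a w))

  offset-next-last : ∀ a w → offset a w ≡ m → offset a (next w) ≡ 0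
  offset-next-last a w eq = offset-≡ a (next w) (s≤s z≤n) (begin
      a                           ≡⟨ next^-period a ⟨
      next (next^ m a)            ≡⟨ cong (λ j → next (next^ j a)) eq ⟨
      next (next^ (offset a w) a) ≡⟨ cong next (next^-offset a w) ⟩
      next w                      ∎)
    where open ≡-Reasoning

  offset-prev : ∀ a w {t} → offset a w ≡ suc t → offset a (prev w) ≡ t
  offset-prev a w {t} eq = offset-≡ a (prev w) (<-trans (n<1+n t) (subst (_< n) eq (offset<n a w))) (begin
      next^ t a                   ≡⟨ prev-next (next^ t a) ⟨
      prev (next^ (suc t) a)      ≡⟨ cong (λ j → prev (next^ j a)) eq ⟨
      prev (next^ (offset a w) a) ≡⟨ cong prev (next^-offset a w) ⟩
      prev w                      ∎)
    where open ≡-Reasoning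

  offset-from-next : ∀ a b → a ≡ b ⊎ offset a b ≡ suc (offset (next a) b)
  offset-from-next a b with m≤n⇒m<n∨m≡n (s≤s⁻¹ (offset<n (next a) b))
  ... | inj₁ j<m = inj₂ (offset-≡ a b (s≤s j<m)
                      (trans (sym (next^-next (offset (next a) b) a)) (next^-offset (next a) b)))
  ... | inj₂ j≡m = inj₁ (begin
      a                                  ≡⟨ next^-period a ⟨
      next^ n a                          ≡⟨ next^-next m a ⟨
      next^ m (next a)                   ≡⟨ cong (λ j → next^ j (next a)) j≡m ⟨
      next^ (offset (next a) b) (next a) ≡⟨ next^-offset (next a) b ⟩
      b                                  ∎)
    where open ≡-Reasoning

  offset-from-prev : ∀ a b → offset (prev a) b ≡ suc (offset a b) ⊎ (offset a b ≡ m × offset (prev a) b ≡ 0)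
  offset-from-prev a b with offset-from-next (prev a) b
  ... | inj₁ refl = inj₂ (offset-next^ a m (n<1+n m) , offset-self (prev a))
  ... | inj₂ eq   = inj₁ (trans eq (cong (λ c → suc (offset c b)) (next-prev a)))

  offset-flip : ∀ a b → offset a b ≢ 0 → offset b a ≡ n ∸ offset a b
  offset-flip a b j≢0 = offset-≡ b a (∸-monoʳ-< (n≢0⇒n>0 j≢0) (<⇒≤ (offset<n a b))) (begin
      next^ (n ∸ j) b              ≡⟨ cong (next^ (n ∸ j)) (next^-offset a b) ⟨
      next^ (n ∸ j) (next^ j a)    ≡⟨ next^-+ (n ∸ j) j a ⟨
      next^ (n ∸ j + j) a          ≡⟨ cong (λ i → next^ i a) (m∸n+n≡m (<⇒≤ (offset<n a b))) ⟩
      next^ n a                    ≡⟨ next^-period a ⟩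
      a                            ∎)
    where
      open ≡-Reasoning
      j : ℕ
      j = offset a b

  adj-next : ∀ a → Adj C a (next a)
  adj-next a = inj₁ (toℕ-fromℕ< _)

  adj-prev : ∀ a → Adj C a (prev a)
  adj-prev a = inj₂ (trans (cong toℕ (sym (next-prev a))) (toℕ-fromℕ< _))

  adj-sym : ∀ {a c} → Adj C a c → Adj C c a
  adj-sym (inj₁ e) = inj₂ e
  adj-sym (inj₂ e) = inj₁ e

  adj⇒next⊎prev : ∀ {a c} → Adj C a c → c ≡ next a ⊎ c ≡ prev a
  adj⇒next⊎prev (inj₁ e) = inj₁ (toℕ-injective (trans e (sym (toℕ-fromℕ< _))))
  adj⇒next⊎prev {a} {c} (inj₂ e) =
    inj₂ (trans (sym (prev-next c)) (cong prev (toℕ-injective (trans (toℕ-fromℕ< _) (sym e)))))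

  snoc : ∀ {x y z k} → Walk C x y k → Adj C y z → Walk C x z (suc k)
  snoc here       y~z = step y~z here
  snoc (step x~ w) y~z = step x~ (snoc w y~z)

  reverse : ∀ {x y k} → Walk C x y k → Walk C y x k
  reverse here        = here
  reverse (step x~ w) = snoc (reverse w) (adj-sym x~)

  walk-next^ : ∀ a j → Walk C a (next^ j a) j
  walk-next^ a zero    = here
  walk-next^ a (suc j) = snoc (walk-next^ a j) (adj-next (next^ j a))

  shortArc : ℕ → ℕ
  shortArc j = j ⊓ (n ∸ j)

  shortArc-suc : ∀ j → shortArc (suc j) ≤ suc (shortArc j)
  shortArc-suc j = ⊓-mono-≤ ≤-refl (≤-trans (∸-monoʳ-≤ n (n≤1+n j)) (n≤1+n (n ∸ j)))

  shortArc≤suc-shortArc-suc : ∀ j → j < n → shortArc j ≤ suc (shortArc (suc j))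
  shortArc≤suc-shortArc-suc j j<n = ⊓-mono-≤ (m≤n+m j 2) (≤-reflexive (+-∸-assoc 1 j<n))

  shortArc-last : shortArc m ≤ 1
  shortArc-last =
    ≤-trans (m⊓n≤n m (n ∸ m)) (≤-reflexive (trans (+-∸-assoc 1 (≤-refl {m})) (cong suc (n∸n≡0 m))))

  cycleDist : Fin n → Fin n → ℕ
  cycleDist a b = shortArc (offset a b)

  cycleDist-next : ∀ a b → cycleDist a b ≤ suc (cycleDist (next a) b)
  cycleDist-next a b with offset-from-next a b
  ... | inj₁ refl = subst (λ j → shortArc j ≤ suc (cycleDist (next a) a)) (sym (offset-self a)) z≤n
  ... | inj₂ eq   = subst (λ j → shortArc j ≤ suc (cycleDist (next a) b)) (sym eq)
                          (shortArc-suc (offset (next a) b))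

  cycleDist-prev : ∀ a b → cycleDist a b ≤ suc (cycleDist (prev a) b)
  cycleDist-prev a b with offset-from-prev a b
  ... | inj₁ eq         = subst (λ j → cycleDist a b ≤ suc (shortArc j)) (sym eq)
                             (shortArc≤suc-shortArc-suc (offset a b) (offset<n a b))
  ... | inj₂ (e₁ , e₂) = subst₂ (λ i j → shortArc i ≤ suc (shortArc j)) (sym e₁) (sym e₂) shortArc-last

  cycleDist≤length : ∀ {a b k} → Walk C a b k → cycleDist a b ≤ k
  cycleDist≤length {a} here = ≤-reflexive (cong shortArc (offset-self a))
  cycleDist≤length {a} {b} (step a~c w) with adj⇒next⊎prev a~c
  ... | inj₁ refl = ≤-trans (cycleDist-next a b) (s≤s (cycleDist≤length w))
  ... | inj₂ refl = ≤-trans (cycleDist-prev a b) (s≤s (cycleDist≤length w))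

  walk-cycleDist : ∀ a b → Walk C a b (cycleDist a b)
  walk-cycleDist a b with offset a b ≤? n ∸ offset a b
  ... | yes j≤ = subst (Walk C a b) (sym (m≤n⇒m⊓n≡m j≤))
                   (subst (λ c → Walk C a c (offset a b)) (next^-offset a b) (walk-next^ a (offset a b)))
  ... | no j≰ = subst (Walk C a b) (trans (offset-flip a b j≢0) (sym (m≥n⇒m⊓n≡n (<⇒≤ (≰⇒> j≰)))))
                   (reverse (subst (λ c → Walk C b c (offset b a)) (next^-offset b a) (walk-next^ b (offset b a))))
    where
      j≢0 : offset a b ≢ 0
      j≢0 j≡0 = j≰ (subst (λ j → j ≤ n ∸ j) (sym j≡0) z≤n)

  dist≡offset⊎complement : ∀ {a b d} → IsDist C a b d → d ≡ offset a b ⊎ offset a b + d ≡ n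
  dist≡offset⊎complement {a} {b} {d} (walk , minimal) =
    ⊎-map (trans d≡) (λ e → trans (cong (offset a b +_) (trans d≡ e)) (m+[n∸m]≡n (<⇒≤ (offset<n a b))))
          (⊓-sel (offset a b) (n ∸ offset a b))
    where
      d≡ : d ≡ cycleDist a b
      d≡ = ≤-antisym (minimal _ (walk-cycleDist a b)) (cycleDist≤length walk)

  sum-next : ∀ (F : Fin n → ℕ) → sum (F ∘ next) ≡ sum F
  sum-next F = sym (sum-permute F (permutation next prev next-prev prev-next))

  sum-prev : ∀ (F : Fin n → ℕ) → sum (F ∘ prev) ≡ sum F
  sum-prev F = sym (sum-permute F (permutation prev next prev-next next-prev))

  -- Each vertex dominates itself and its two neighbours.
  n≤3*∣dominating∣ : ∀ S → Dominating C S → n ≤ 3 * ∣ S ∣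
  n≤3*∣dominating∣ S dom = begin
      n                                             ≡⟨ sum-const-1 n ⟨
      sum {n} (λ _ → 1)                             ≤⟨ sum-mono-≤ closed-neighbourhood ⟩
      sum (λ v → c v + c (next v) + c (prev v))     ≡⟨ ∑-distrib-+ (λ v → c v + c (next v)) (c ∘ prev) ⟩
      sum (λ v → c v + c (next v)) + sum (c ∘ prev) ≡⟨ cong (_+ sum (c ∘ prev)) (∑-distrib-+ c (c ∘ next)) ⟩
      sum c + sum (c ∘ next) + sum (c ∘ prev)       ≡⟨ cong₂ (λ p q → sum c + p + q) (sum-next c) (sum-prev c) ⟩
      sum c + sum c + sum c                         ≡⟨ thrice (sum c) ⟩
      3 * sum c                                     ≡⟨ cong (3 *_) (∣S∣≡sum-bit S) ⟨
      3 * ∣ S ∣                                     ∎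
    where
      open ≤-Reasoning
      c : Fin n → ℕ
      c i = bit (lookup S i)
      thrice : ∀ x → x + x + x ≡ 3 * x
      thrice = solve-∀
      c≥1 : ∀ {i} → i ∈ S → 1 ≤ c i
      c≥1 i∈S rewrite []=⇒lookup i∈S = ≤-refl
      closed-neighbourhood : ∀ v → 1 ≤ c v + c (next v) + c (prev v)
      closed-neighbourhood v with dom v
      ... | inj₁ v∈S = ≤-trans (c≥1 v∈S) (≤-trans (m≤m+n (c v) _) (m≤m+n _ _))
      ... | inj₂ (u , u∈S , u~v) with adj⇒next⊎prev u~v
      ...   | inj₁ refl = ≤-trans (c≥1 (subst (_∈ S) (sym (prev-next u)) u∈S)) (m≤n+m _ _)
      ...   | inj₂ refl = ≤-trans (c≥1 (subst (_∈ S) (sym (next-prev u)) u∈S))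
                                  (≤-trans (m≤n+m (c (next (prev u))) (c (prev u))) (m≤m+n _ _))

  sum-bit-offset : ∀ a (g : ℕ → Bool) → sum (λ w → bit (g (offset a w))) ≡ countBelow g n
  sum-bit-offset a g = begin
      sum (λ w → bit (g (offset a w)))       ≡⟨ sum-cong-≗ (λ w → cong (bit ∘ g) (toℕ-fromℕ< (offset<n a w))) ⟨
      sum (λ w → bit (g (toℕ (position w)))) ≡⟨ sum-permute (λ t → bit (g (toℕ t))) positions ⟨
      sum {n} (λ t → bit (g (toℕ t)))        ≡⟨ sum≡countBelow n g ⟩
      countBelow g n                         ∎
    where
      open ≡-Reasoning
      position : Fin n → Fin n
      position w = fromℕ< (offset<n a w)
      positions : Permutation n n
      positions = permutation position (λ t → next^ (toℕ t) a)
        (λ t → toℕ-injective (trans (toℕ-fromℕ< _) (offset-next^ a (toℕ t) (toℕ<n t))))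
        (λ w → trans (cong (λ j → next^ j a) (toℕ-fromℕ< (offset<n a w))) (next^-offset a w))

  Covered : (ℕ → Bool) → ℕ → Set
  Covered g t = g t ≡ true ⊎ (suc t < n × g (suc t) ≡ true)
              ⊎ ∃[ t′ ] (t ≡ suc t′ × g t′ ≡ true) ⊎ (t ≡ m × g 0 ≡ true)

  covered⇒dominated : ∀ a g w → Covered g (offset a w) → DominatedBy C (g ∘ offset a) w
  covered⇒dominated a g w (inj₁ p) = inj₁ p
  covered⇒dominated a g w (inj₂ (inj₁ (lt , p))) =
    inj₂ (next w , subst (λ j → g j ≡ true) (sym (offset-next a w lt)) p , adj-sym (adj-next w))
  covered⇒dominated a g w (inj₂ (inj₂ (inj₁ (t′ , eq , p)))) =
    inj₂ (prev w , subst (λ j → g j ≡ true) (sym (offset-prev a w eq)) p , adj-sym (adj-prev w))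
  covered⇒dominated a g w (inj₂ (inj₂ (inj₂ (eq , p)))) =
    inj₂ (next w , subst (λ j → g j ≡ true) (sym (offset-next-last a w eq)) p , adj-sym (adj-next w))

  -- The last hypothesis handles the end of an arc: the offset after it starts the
  -- next arc, which is chosen only when α = 0.
  stride3-covers-below : ∀ {s α t} → s < n → α < 3 → t < s → α ≤ suc t →
    (mod3 s ≡ α → α ≡ 0) → Covered (stride3 s α) t
  stride3-covers-below {s} {α} {t} s<n α<3 t<s α≤ boundary with residue-near t α<3 α≤
  ... | inj₁ e = inj₁ (stride3-below-∈ t<s e)
  ... | inj₂ (inj₂ (t′ , refl , e)) =
    inj₂ (inj₂ (inj₁ (t′ , refl , stride3-below-∈ (<-trans (n<1+n t′) t<s) e)))
  ... | inj₂ (inj₁ e) with m≤n⇒m<n∨m≡n t<s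
  ...   | inj₁ st<s = inj₂ (inj₁ (<-trans st<s s<n , stride3-below-∈ st<s e))
  ...   | inj₂ refl =
    inj₂ (inj₁ (s<n , stride3-above-∈ ≤-refl (trans (cong mod3 (n∸n≡0 (suc t))) (sym (boundary e)))))

  stride3-covers-above : ∀ {s α t} → s ≤ t → t < n → α < 3 → α ≤ suc (t ∸ s) →
    (mod3 (n ∸ s) ≡ α → α ≡ 0) → Covered (stride3 s α) t
  stride3-covers-above {s} {α} {t} s≤t t<n α<3 α≤ boundary with residue-near (t ∸ s) α<3 α≤
  ... | inj₁ e = inj₁ (stride3-above-∈ s≤t e)
  ... | inj₂ (inj₂ (i′ , eq , e)) =
    inj₂ (inj₂ (inj₁ (s + i′ , t≡ , stride3-above-∈ (m≤m+n s i′) (trans (cong mod3 (m+n∸m≡n s i′)) e))))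
    where
      t≡ : t ≡ suc (s + i′)
      t≡ = trans (sym (m+[n∸m]≡n s≤t)) (trans (cong (s +_) eq) (+-suc s i′))
  ... | inj₂ (inj₁ e) with m≤n⇒m<n∨m≡n t<n
  ...   | inj₁ st<n =
    inj₂ (inj₁ (st<n , stride3-above-∈ (m≤n⇒m≤1+n s≤t) (trans (cong mod3 (+-∸-assoc 1 s≤t)) e)))
  ...   | inj₂ st≡n =
    inj₂ (inj₂ (inj₂ (suc-injective st≡n , subst (λ β → stride3 s β 0 ≡ true) (sym α≡0) (stride3-origin s))))
    where
      α≡0 : α ≡ 0
      α≡0 = boundary (trans (cong mod3 (trans (cong (_∸ s) (sym st≡n)) (+-∸-assoc 1 s≤t))) e)

  stride3-0-covers : ∀ {s t} → s < n → t < n → Covered (stride3 s 0) t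
  stride3-0-covers {s} {t} s<n t<n with t <? s
  ... | yes t<s = stride3-covers-below s<n (s≤s z≤n) t<s z≤n (λ _ → refl)
  ... | no t≮s  = stride3-covers-above (≮⇒≥ t≮s) t<n (s≤s z≤n) z≤n (λ _ → refl)

  stride3-2-covers : ∀ {s t} → s < n → mod3 s ≡ 1 → mod3 (n ∸ s) ≡ 1 → t < n → t ≢ 0 → t ≢ s →
    Covered (stride3 s 2) t
  stride3-2-covers {s} {t} s<n s≡1 s′≡1 t<n t≢0 t≢s with t <? s
  ... | yes t<s = stride3-covers-below s<n 2<3 t<s (2≤suc t≢0) (λ e → contradiction (trans (sym s≡1) e) λ ())
  ... | no t≮s  = stride3-covers-above s≤t t<n 2<3 (2≤suc t∸s≢0) (λ e → contradiction (trans (sym s′≡1) e) λ ())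
    where
      s≤t : s ≤ t
      s≤t = ≮⇒≥ t≮s
      t∸s≢0 : t ∸ s ≢ 0
      t∸s≢0 eq = t≢s (≤-antisym (m∸n≡0⇒m≤n eq) s≤t)

-- The cycle C_{3k+2}

module Cycle3k+2 (k : ℕ) where
  open CyclicOffsets (suc (k * 3))

  mod3-n : mod3 n ≡ 2
  mod3-n = trans (cong mod3 (+-comm 2 (k * 3))) (mod3-*3+ k 2)

  mod3-complement : ∀ a b → a + b ≡ n → mod3 a + mod3 b ≡ 2
  mod3-complement a b eq = mod3-+≡2 a b (trans (cong mod3 eq) mod3-n)

  mod3-n∸≡1 : ∀ {a} → a ≤ n → mod3 a ≡ 1 → mod3 (n ∸ a) ≡ 1
  mod3-n∸≡1 {a} a≤n =
    complement-of-1 (trans (+-comm (mod3 (n ∸ a)) (mod3 a)) (mod3-complement a (n ∸ a) (m+[n∸m]≡n a≤n)))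

  dist-residue : ∀ {a b d} → IsDist C a b d → mod3 d ≡ 1 ⇔ mod3 (offset a b) ≡ 1
  dist-residue {a} {b} {d} D with dist≡offset⊎complement D
  ... | inj₁ refl = mk⇔ id id
  ... | inj₂ eq   =
    mk⇔ (complement-of-1 residues≡2) (complement-of-1 (trans (+-comm (mod3 d) (mod3 (offset a b))) residues≡2))
    where
      residues≡2 : mod3 (offset a b) + mod3 d ≡ 2
      residues≡2 = mod3-complement (offset a b) d eq

  residues-+ : ∀ {α} a b → α < 3 → a + b ≡ n →
    residues α a + residues α b ≡ k + (residues α (mod3 a) + residues α (mod3 b))
  residues-+ {α} a b α<3 eq = begin
      residues α a + residues α b
        ≡⟨ cong₂ _+_ (residues-div3 a α<3) (residues-div3 b α<3) ⟩
      (div3 a + residues α (mod3 a)) + (div3 b + residues α (mod3 b))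
        ≡⟨ regroup (div3 a) _ (div3 b) _ ⟩
      (div3 a + div3 b) + (residues α (mod3 a) + residues α (mod3 b))
        ≡⟨ cong (_+ _) (div3-+ a b k eq (mod3-complement a b eq)) ⟩
      k + (residues α (mod3 a) + residues α (mod3 b))
        ∎
    where
      open ≡-Reasoning
      regroup : ∀ p ρ q σ → (p + ρ) + (q + σ) ≡ (p + q) + (ρ + σ)
      regroup = solve-∀

  γ-cycle≥ : ∀ {γ} → IsDominationNumber C γ → suc k ≤ γ
  γ-cycle≥ {γ} ((S , S-dominating , ∣S∣≡γ) , _) = *-cancelˡ-< 3 k γ (<-≤-trans 3k<n n≤3γ)
    where
      3k<n : 3 * k < n
      3k<n = subst (_< n) (*-comm k 3) (m<n+m (k * 3) z<s)
      n≤3γ : n ≤ 3 * γ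
      n≤3γ = subst (λ g → n ≤ 3 * g) ∣S∣≡γ (n≤3*∣dominating∣ S S-dominating)

  module Witness (f : Fin n → Fin n) (x y : Fin n)
                 (r≡1 : mod3 (offset x y) ≡ 1) (s≢1 : mod3 (offset (f x) (f y)) ≢ 1) where
    r s : ℕ
    r = offset x y
    s = offset (f x) (f y)

    chosen₁ chosen₂ : Fin n → Bool
    chosen₁ = stride3 r 2 ∘ offset x
    chosen₂ = stride3 s 0 ∘ offset (f x)

    n∸r≡1 : mod3 (n ∸ r) ≡ 1
    n∸r≡1 = mod3-n∸≡1 (<⇒≤ (offset<n x y)) r≡1

    dominated₁ : ∀ w → DominatedBy C chosen₁ w ⊎ chosen₂ (f w) ≡ true
    dominated₁ w with w ≟ x | w ≟ y
    ... | yes refl | _        =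
      inj₂ (subst (λ j → stride3 s 0 j ≡ true) (sym (offset-self (f x))) (stride3-origin s))
    ... | no _     | yes refl = inj₂ (stride3-start s)
    ... | no w≢x   | no w≢y   = inj₁ (covered⇒dominated x (stride3 r 2) w
          (stride3-2-covers (offset<n x y) r≡1 n∸r≡1 (offset<n x w)
            (λ e → w≢x (sym (offset-injective x (trans (offset-self x) (sym e)))))
            (λ e → w≢y (offset-injective x e))))

    dominated₂ : ∀ w → DominatedBy C chosen₂ w
    dominated₂ w =
      covered⇒dominated (f x) (stride3 s 0) w (stride3-0-covers (offset<n (f x) (f y)) (offset<n (f x) w))

    dominating : Dominating (Functigraph C f) (tabulate (chosen₁ ++ chosen₂))
    dominating = functigraph-dominating C f chosen₁ chosen₂ dominated₁ dominated₂

    count₁ : residues 2 r + residues 2 (n ∸ r) ≡ k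
    count₁ = trans (residues-+ r (n ∸ r) 2<3 (m+[n∸m]≡n (<⇒≤ (offset<n x y))))
                   (trans (cong₂ (λ ρ σ → k + (residues 2 ρ + residues 2 σ)) r≡1 n∸r≡1) (+-identityʳ k))

    count₂ : residues 0 s + residues 0 (n ∸ s) ≡ suc k
    count₂ = trans (residues-+ s (n ∸ s) (s≤s z≤n) s+[n∸s]≡n)
                   (trans (cong (k +_) (residues-0-pair _ _ (mod3-complement s (n ∸ s) s+[n∸s]≡n) s≢1))
                          (+-comm k 1))
      where
        s+[n∸s]≡n : s + (n ∸ s) ≡ n
        s+[n∸s]≡n = m+[n∸m]≡n (<⇒≤ (offset<n (f x) (f y)))

    ∣dominating∣ : ∣ tabulate (chosen₁ ++ chosen₂) ∣ ≡ k + suc k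
    ∣dominating∣ = begin
        ∣ tabulate (chosen₁ ++ chosen₂) ∣
          ≡⟨ ∣tabulate-++∣ chosen₁ chosen₂ ⟩
        sum (bit ∘ chosen₁) + sum (bit ∘ chosen₂)
          ≡⟨ cong₂ _+_ (sum-bit-offset x (stride3 r 2)) (sum-bit-offset (f x) (stride3 s 0)) ⟩
        countBelow (stride3 r 2) n + countBelow (stride3 s 0) n
          ≡⟨ cong₂ _+_ (countBelow-stride3 2 (<⇒≤ (offset<n x y)))
                       (countBelow-stride3 0 (<⇒≤ (offset<n (f x) (f y)))) ⟩
        (residues 2 r + residues 2 (n ∸ r)) + (residues 0 s + residues 0 (n ∸ s))
          ≡⟨ cong₂ _+_ count₁ count₂ ⟩
        k + suc k
          ∎
      where open ≡-Reasoning

  γ-functigraph< : (f : Fin n → Fin n) →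
    (∃[ x ] ∃[ y ] ∃[ d₁ ] ∃[ d₂ ]
      (IsDist C x y d₁ × IsDist C (f x) (f y) d₂ × d₁ % 3 ≡ 1 × d₂ % 3 ≢ 1)) →
    (γC γF : ℕ) → IsDominationNumber C γC → IsDominationNumber (Functigraph C f) γF →
    γF < 2 * γC
  γ-functigraph< f (x , y , d₁ , d₂ , D₁ , D₂ , d₁≡1 , d₂≢1) γC γF γC-spec (_ , γF-minimal) = begin-strict
      γF                                ≤⟨ γF-minimal _ dominating ⟩
      ∣ tabulate (chosen₁ ++ chosen₂) ∣ ≡⟨ ∣dominating∣ ⟩
      k + suc k                         <⟨ +-monoˡ-< (suc k) (n<1+n k) ⟩
      suc k + suc k                     ≤⟨ +-mono-≤ k<γC (≤-trans k<γC (m≤m+n γC 0)) ⟩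
      2 * γC                            ∎
    where
      open ≤-Reasoning
      k<γC : suc k ≤ γC
      k<γC = γ-cycle≥ γC-spec
      open Witness f x y (Equivalence.to (dist-residue D₁) (trans (sym (%3≡mod3 d₁)) d₁≡1))
                         (λ e → d₂≢1 (trans (%3≡mod3 d₂) (Equivalence.from (dist-residue D₂) e)))

3*k+2≡2+k*3 : ∀ k → 3 * k + 2 ≡ 2 + k * 3
3*k+2≡2+k*3 = solve-∀

-- The rewrite puts the size in the form suc (suc _) on which cycleAdj computes.
-- The construction also works for k = 0.
theorem4p6 : (k : ℕ) → 1 ≤ k →
    (f : Fin (3 * k + 2) → Fin (3 * k + 2)) →
    (∃[ x ] ∃[ y ] ∃[ d₁ ] ∃[ d₂ ]
      (IsDist (Cycle (3 * k + 2)) x y d₁ × IsDist (Cycle (3 * k + 2)) (f x) (f y) d₂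
        × d₁ % 3 ≡ 1 × d₂ % 3 ≢ 1)) →
    (γC γF : ℕ) → IsDominationNumber (Cycle (3 * k + 2)) γC →
    IsDominationNumber (Functigraph (Cycle (3 * k + 2)) f) γF →
    γF < 2 * γC
theorem4p6 k _ rewrite 3*k+2≡2+k*3 k = Cycle3k+2.γ-functigraph< k
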